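{- Let $G$ be a connected graph with $p$ vertices and $q$ edges that satisfies property $(\dagger)$. Then $W_\epsilon(\overline{G})=2q$.
   Context: Graphs are finite, simple, undirected. For a connected graph $H$ with vertices $v_1,\ldots,v_n$, $d(v_i,v_j)$ is the distance and $e(v_i)=\max_j d(v_i,v_j)$ the eccentricity. The eccentricity matrix $\epsilon(H)$ has $(i,j)$ entry $d(v_i,v_j)$ if $d(v_i,v_j)=\min\{e(v_i),e(v_j)\}$ and $0$ otherwise. The eccentricity Wiener index is $W_\epsilon(H)=\frac12\sum_{i,j}(\epsilon(H))_{ij}$. $\overline{G}$ is the complement of $G$. A graph satisfies property $(\dagger)$ if for any two adjacent vertices $u,v$ there is a third vertex $w$ adjacent to neither $u$ nor $v$. -}

module Defs where

open import Data.Nat using (ℕ; zero; suc; _+_; _⊔_; _⊓_; _<ᵇ_; _≡ᵇ_)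
open import Data.Nat.DivMod using (_/_)
open import Data.Bool using (Bool; true; false; _∧_; _∨_; not; if_then_else_)
open import Data.Fin using (Fin; toℕ)
open import Data.Fin.Properties using (_≟_)
open import Data.List using (List; []; _∷_; map; foldr; allFin)
open import Data.Nat.ListAction using (sum)
open import Data.Bool.ListAction using (any)
open import Data.Product using (∃; _×_; _,_)
open import Relation.Nullary using (¬_; does)
open import Relation.Binary.PropositionalEquality using (_≡_)

record Graph (p : ℕ) : Set where
  field
    adj   : Fin p → Fin p → Bool
    adj-sym : ∀ i j → adj i j ≡ adj j i
    adj-irrefl : ∀ i → adj i i ≡ false
open Graph public

_==_ : ∀ {p} → Fin p → Fin p → Bool
i == j = does (i ≟ j)

complement : ∀ {p} → Graph p → Graph p
complement {p} G = record
  { adj = λ i j → not (adj G i j) ∧ not (i == j)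
  ; adj-sym = symC
  ; adj-irrefl = irrC }
  where
  open import Relation.Binary.PropositionalEquality using (refl; cong₂; sym)
  open import Relation.Nullary using (yes; no)
  eqsym : ∀ (i j : Fin p) → (i == j) ≡ (j == i)
  eqsym i j with i ≟ j | j ≟ i
  ... | yes _ | yes _ = refl
  ... | no _  | no _  = refl
  ... | yes e | no n  = Data.Empty.⊥-elim (n (sym e)) where import Data.Empty
  ... | no n  | yes e = Data.Empty.⊥-elim (n (sym e)) where import Data.Empty
  symC : ∀ i j → (not (adj G i j) ∧ not (i == j)) ≡ (not (adj G j i) ∧ not (j == i))
  symC i j = cong₂ (λ a b → not a ∧ not b) (adj-sym G i j) (eqsym i j)
  irrC : ∀ i → (not (adj G i i) ∧ not (i == i)) ≡ false
  irrC i with i ≟ i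
  ... | yes _ = Data.Bool.Properties.∧-zeroʳ (not (adj G i i))
    where import Data.Bool.Properties
  ... | no n = Data.Empty.⊥-elim (n refl) where import Data.Empty

reach : ∀ {p} → Graph p → ℕ → Fin p → Fin p → Bool
reach G zero    i j = i == j
reach G (suc k) i j = reach G k i j ∨ any (λ m → reach G k i m ∧ adj G m j) (allFin _)

Connected : ∀ {p} → Graph p → Set
Connected G = ∀ i j → ∃ λ k → reach G k i j ≡ true

private
  search : ∀ {p} → Graph p → ℕ → ℕ → Fin p → Fin p → ℕ
  search G k zero i j = k
  search G k (suc n) i j = if reach G k i j then k else search G (suc k) n i j

-- In a graph on p vertices any reachable vertex is at distance < p, so
-- searching k = 0,…,p-1 is exhaustive; for a connected graph this is the true distance.
dist : ∀ {p} → Graph p → Fin p → Fin p → ℕ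
dist {p} G i j = search G 0 p i j

maxL : List ℕ → ℕ
maxL = foldr _⊔_ 0

ecc : ∀ {p} → Graph p → Fin p → ℕ
ecc G i = maxL (map (dist G i) (allFin _))

εM : ∀ {p} → Graph p → Fin p → Fin p → ℕ
εM G i j = if dist G i j ≡ᵇ (ecc G i ⊓ ecc G j) then dist G i j else 0

Wε : ∀ {p} → Graph p → ℕ
Wε G = sum (map (λ i → sum (map (εM G i) (allFin _))) (allFin _)) / 2

edges : ∀ {p} → Graph p → ℕ
edges G = sum (map (λ i → sum (map (λ j → if (toℕ i <ᵇ toℕ j) ∧ adj G i j then 1 else 0) (allFin _))) (allFin _))

Dagger : ∀ {p} → Graph p → Set
Dagger G = ∀ u v → adj G u v ≡ true →
  ∃ λ w → ¬ (w ≡ u) × ¬ (w ≡ v) × adj G u w ≡ false × adj G v w ≡ false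

{-# OPTIONS --safe #-}
module Submission where

-- In the complement H of G two distinct vertices are at distance 1 when they are
-- non-adjacent in G, and at distance 2 when they are adjacent in G: the vertex w
-- given by (†) is then a common neighbour in H.  Since G is connected, every vertex
-- has a G-neighbour (as soon as p ≥ 2), so every eccentricity in H equals 2.  Hence
-- ε(H) is twice the adjacency matrix of G, and W_ε(H) = ½ · 2 · 2q by the handshake lemma.

open import Defs
open import Data.Nat using (ℕ; _*_)
open import Relation.Binary.PropositionalEquality using (_≡_)

open import Data.Nat using (zero; suc; _+_; _≤_; _<ᵇ_; _≡ᵇ_; _⊓_; z≤n; s≤s)
open import Data.Nat.Properties
  using (+-*-semiring; ≤-reflexive; ≤-antisym; ⊔-lub; m≤n⇒m≤n⊔o; m≤n⇒m≤o⊔n; *-comm;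
         +-identityʳ; <-asym; ≮⇒≥; <ᵇ-reflects-<)
open import Data.Nat.DivMod using (_/_; m*n/n≡m)
open import Data.Nat.ListAction using (sum)
open import Algebra.Properties.Semiring.Sum +-*-semiring
  using (sum-syntax; sum-cong-≗; ∑-comm; ∑-distrib-+; *-distribˡ-sum)
open import Data.Bool using (Bool; true; false; _∧_; _∨_; if_then_else_)
open import Data.Bool.ListAction using (any)
open import Data.Bool.Properties using (T-≡; ∧-conicalˡ; ∧-conicalʳ; ∨-zeroʳ; ¬-not)
open import Data.Fin as Fin using (Fin; toℕ)
open import Data.Fin.Properties using (_≟_; toℕ-injective)
open import Data.List using (map; tabulate; allFin)
open import Data.List.Membership.Propositional using (_∈_; lose)
open import Data.List.Membership.Propositional.Properties using (∈-allFin)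
open import Data.List.Properties using (map-tabulate; foldr-preservesᵇ; foldr-preservesᵒ)
import Data.List.Relation.Unary.All.Properties as All
import Data.List.Relation.Unary.Any as Any
import Data.List.Relation.Unary.Any.Properties as Any
open import Data.Product using (∃; _,_)
open import Data.Sum using (_⊎_; inj₁; inj₂; [_,_])
open import Function using (Equivalence)
open import Relation.Binary.PropositionalEquality
  using (_≢_; refl; sym; trans; cong; cong₂; ≢-sym; module ≡-Reasoning)
open import Relation.Nullary using (yes; no; contradiction)
open import Relation.Nullary.Decidable using (dec-true; dec-false)
open import Relation.Nullary.Reflects using (ofʸ; ofⁿ)

private
  variable
    p : ℕ

any-intro : ∀ {A : Set} (f : A → Bool) {x xs} → x ∈ xs → f x ≡ true → any f xs ≡ true
any-intro f x∈xs fx = Equivalence.to T-≡ (Any.any⁺ f (lose x∈xs (Equivalence.from T-≡ fx)))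

any-witness : ∀ {A : Set} (f : A → Bool) xs → any f xs ≡ true → ∃ λ x → f x ≡ true
any-witness f xs e with Any.satisfied (Any.any⁻ f xs (Equivalence.from T-≡ e))
... | x , fx = x , Equivalence.to T-≡ fx

≤-maxL : ∀ {x} xs → x ∈ xs → x ≤ maxL xs
≤-maxL xs x∈xs = foldr-preservesᵒ (λ x y → [ m≤n⇒m≤n⊔o y , m≤n⇒m≤o⊔n x ]) 0 xs
  (inj₂ (Any.map ≤-reflexive x∈xs))

sum-allFin : ∀ {n} (f : Fin n → ℕ) → sum (map f (allFin n)) ≡ ∑[ i < n ] f i
sum-allFin f = trans (cong sum (map-tabulate (λ i → i) f)) (sum-tabulate f)
  where
  sum-tabulate : ∀ {n} (g : Fin n → ℕ) → sum (tabulate g) ≡ ∑[ i < n ] g i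
  sum-tabulate {zero}  g = refl
  sum-tabulate {suc n} g = cong (g Fin.zero +_) (sum-tabulate (λ i → g (Fin.suc i)))

double-sum-allFin : ∀ {m n} (f : Fin m → Fin n → ℕ) →
  sum (map (λ i → sum (map (f i) (allFin n))) (allFin m)) ≡ ∑[ i < m ] ∑[ j < n ] f i j
double-sum-allFin {n = n} f =
  trans (sum-allFin (λ i → sum (map (f i) (allFin n)))) (sum-cong-≗ (λ i → sum-allFin (f i)))

*-distribˡ-double-sum : ∀ {m n} x (f : Fin m → Fin n → ℕ) →
  x * (∑[ i < m ] ∑[ j < n ] f i j) ≡ ∑[ i < m ] ∑[ j < n ] (x * f i j)
*-distribˡ-double-sum {n = n} x f =
  trans (*-distribˡ-sum x (λ i → ∑[ j < n ] f i j)) (sum-cong-≗ λ i → *-distribˡ-sum x (f i))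

==-refl : (i : Fin p) → (i == i) ≡ true
==-refl i = dec-true (i ≟ i) refl

==-≢ : {i j : Fin p} → i ≢ j → (i == j) ≡ false
==-≢ {i = i} {j} = dec-false (i ≟ j)

==⇒≡ : {i j : Fin p} → (i == j) ≡ true → i ≡ j
==⇒≡ {i = i} {j} e with i ≟ j
... | yes i≡j = i≡j

adj⇒≢ : (K : Graph p) → ∀ {i j} → adj K i j ≡ true → i ≢ j
adj⇒≢ K {i} a refl = contradiction (trans (sym (adj-irrefl K i)) a) λ ()

reach-refl : (K : Graph p) → ∀ k i → reach K k i i ≡ true
reach-refl K zero    i = ==-refl i
reach-refl K (suc k) i rewrite reach-refl K k i = refl

reach-step : (K : Graph p) → ∀ k {i m j} →
  reach K k i m ≡ true → adj K m j ≡ true → reach K (suc k) i j ≡ true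
reach-step K k {i} {m} {j} r a =
  trans (cong (reach K k i j ∨_) (any-intro _ (∈-allFin m) (cong₂ _∧_ r a))) (∨-zeroʳ _)

reach⇒≡⊎neighbour : (K : Graph p) → ∀ k {i j} →
  reach K k i j ≡ true → i ≡ j ⊎ ∃ λ m → adj K i m ≡ true
reach⇒≡⊎neighbour K zero    r = inj₁ (==⇒≡ r)
reach⇒≡⊎neighbour K (suc k) {i} {j} r with reach K k i j in r′
... | true  = reach⇒≡⊎neighbour K k r′
... | false with any-witness _ (allFin _) r
...   | m , walk∧edge with reach⇒≡⊎neighbour K k {i} {m} (∧-conicalˡ _ _ walk∧edge)
...     | inj₁ refl = inj₂ (j , ∧-conicalʳ _ _ walk∧edge)
...     | inj₂ step = inj₂ step

reach-1⇒≡⊎adj : (K : Graph p) → ∀ {i j} → reach K 1 i j ≡ true → i ≡ j ⊎ adj K i j ≡ true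
reach-1⇒≡⊎adj K {i} {j} r with i == j in i=j
... | true  = inj₁ (==⇒≡ i=j)
... | false with any-witness _ (allFin _) r
...   | m , i=m∧edge with ==⇒≡ {i = i} {m} (∧-conicalˡ _ _ i=m∧edge)
...     | refl = inj₂ (∧-conicalʳ _ _ i=m∧edge)

reach-1-nonadjacent : (K : Graph p) → ∀ {i j} → i ≢ j → adj K i j ≡ false → reach K 1 i j ≡ false
reach-1-nonadjacent K i≢j ¬a = ¬-not λ r →
  [ i≢j , (λ a → contradiction (trans (sym ¬a) a) λ ()) ] (reach-1⇒≡⊎adj K r)

connected⇒neighbour : (K : Graph p) → Connected K → ∀ {i j} → i ≢ j → ∃ λ m → adj K i m ≡ true
connected⇒neighbour K conn {i} {j} i≢j with conn i j
... | k , r = [ (λ i≡j → contradiction i≡j i≢j) , (λ step → step) ] (reach⇒≡⊎neighbour K k r)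

dist-refl : (K : Graph p) → ∀ i → dist K i i ≡ 0
dist-refl {p = suc _} K i rewrite ==-refl i = refl

dist≡1 : (K : Graph p) → ∀ {i j} → i ≢ j → reach K 1 i j ≡ true → dist K i j ≡ 1
dist≡1 {p = suc zero}    K {Fin.zero} {Fin.zero} i≢j _ = contradiction refl i≢j
dist≡1 {p = suc (suc _)} K i≢j r₁ rewrite ==-≢ i≢j | r₁ = refl

-- The search behind dist stops at k = p, so for p = 2 the value 2 comes out
-- without consulting reach K 2.
dist≡2 : (K : Graph p) → ∀ {i j} → i ≢ j →
  reach K 1 i j ≡ false → reach K 2 i j ≡ true → dist K i j ≡ 2
dist≡2 {p = suc zero}          K {Fin.zero} {Fin.zero} i≢j _ _ = contradiction refl i≢j
dist≡2 {p = suc (suc zero)}    K i≢j r₁ _  rewrite ==-≢ i≢j | r₁ = refl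
dist≡2 {p = suc (suc (suc _))} K i≢j r₁ r₂ rewrite ==-≢ i≢j | r₁ | r₂ = refl

dist-adjacent : (K : Graph p) → ∀ {i j} → adj K i j ≡ true → dist K i j ≡ 1
dist-adjacent K {i} a = dist≡1 K (adj⇒≢ K a) (reach-step K 0 {i} (reach-refl K 0 i) a)

dist-common-neighbour : (K : Graph p) → ∀ {i j w} → i ≢ j → adj K i j ≡ false →
  adj K i w ≡ true → adj K w j ≡ true → dist K i j ≡ 2
dist-common-neighbour K {i} i≢j ¬a a₁ a₂ = dist≡2 K i≢j (reach-1-nonadjacent K i≢j ¬a)
  (reach-step K 1 {i} (reach-step K 0 {i} (reach-refl K 0 i) a₁) a₂)

ecc≡ : (K : Graph p) → ∀ {i m d} → (∀ j → dist K i j ≤ d) → dist K i m ≡ d → ecc K i ≡ d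
ecc≡ K {i} {m} {d} bounded attained = ≤-antisym
  (foldr-preservesᵇ {P = _≤ d} ⊔-lub z≤n (All.map⁺ (All.tabulate⁺ bounded)))
  (≤-maxL _ (Any.map⁺ (Any.tabulate⁺ m (sym attained))))

εM-diagonal : (K : Graph p) → ∀ i → εM K i i ≡ 0
εM-diagonal K i rewrite dist-refl K i with 0 ≡ᵇ (ecc K i ⊓ ecc K i)
... | true  = refl
... | false = refl

adjacency : Graph p → Fin p → Fin p → ℕ
adjacency G i j = if adj G i j then 1 else 0

upperAdjacency : Graph p → Fin p → Fin p → ℕ
upperAdjacency G i j = if (toℕ i <ᵇ toℕ j) ∧ adj G i j then 1 else 0

adjacency-split : (G : Graph p) → ∀ i j →
  adjacency G i j ≡ upperAdjacency G i j + upperAdjacency G j i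
adjacency-split G i j
  with toℕ i <ᵇ toℕ j | <ᵇ-reflects-< (toℕ i) (toℕ j) | toℕ j <ᵇ toℕ i | <ᵇ-reflects-< (toℕ j) (toℕ i)
... | true  | ofʸ i<j | true  | ofʸ j<i = contradiction j<i (<-asym i<j)
... | true  | _       | false | _       = sym (+-identityʳ _)
... | false | _       | true  | _       = cong (if_then 1 else 0) (adj-sym G i j)
... | false | ofⁿ i≮j | false | ofⁿ j≮i with toℕ-injective (≤-antisym (≮⇒≥ j≮i) (≮⇒≥ i≮j))
...   | refl rewrite adj-irrefl G i = refl

handshake : (G : Graph p) → ∑[ i < p ] ∑[ j < p ] adjacency G i j ≡ 2 * edges G
handshake {p} G = begin
  ∑[ i < p ] ∑[ j < p ] adjacency G i j
    ≡⟨ sum-cong-≗ (λ i → sum-cong-≗ (adjacency-split G i)) ⟩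
  ∑[ i < p ] ∑[ j < p ] (U i j + U j i)
    ≡⟨ sum-cong-≗ (λ i → ∑-distrib-+ (U i) (λ j → U j i)) ⟩
  ∑[ i < p ] (∑[ j < p ] U i j + ∑[ j < p ] U j i)
    ≡⟨ ∑-distrib-+ (λ i → ∑[ j < p ] U i j) (λ i → ∑[ j < p ] U j i) ⟩
  ∑[ i < p ] ∑[ j < p ] U i j + ∑[ i < p ] ∑[ j < p ] U j i
    ≡⟨ cong (∑[ i < p ] ∑[ j < p ] U i j +_) (∑-comm (λ i j → U j i)) ⟩
  ∑[ i < p ] ∑[ j < p ] U i j + ∑[ i < p ] ∑[ j < p ] U i j
    ≡⟨ cong (λ e → e + e) (sym (double-sum-allFin U)) ⟩
  edges G + edges G
    ≡⟨ cong (edges G +_) (sym (+-identityʳ (edges G))) ⟩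
  2 * edges G ∎
  where
  open ≡-Reasoning
  U = upperAdjacency G

complement-adj : (G : Graph p) → ∀ {i j} → i ≢ j → adj G i j ≡ false → adj (complement G) i j ≡ true
complement-adj G i≢j ¬a rewrite ¬a | ==-≢ i≢j = refl

complement-nonadj : (G : Graph p) → ∀ {i j} → adj G i j ≡ true → adj (complement G) i j ≡ false
complement-nonadj G a rewrite a = refl

dist-complement-nonedge : (G : Graph p) → ∀ {i j} → i ≢ j → adj G i j ≡ false →
  dist (complement G) i j ≡ 1
dist-complement-nonedge G i≢j ¬a = dist-adjacent (complement G) (complement-adj G i≢j ¬a)

module _ (G : Graph p) (dagger : Dagger G) where

  private
    H : Graph p
    H = complement G

  dist-complement-edge : ∀ {i j} → adj G i j ≡ true → dist H i j ≡ 2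
  dist-complement-edge {i} {j} a with dagger i j a
  ... | w , w≢i , w≢j , ¬aiw , ¬ajw =
    dist-common-neighbour H (adj⇒≢ G a) (complement-nonadj G a)
      (complement-adj G (≢-sym w≢i) ¬aiw)
      (complement-adj G w≢j (trans (adj-sym G w j) ¬ajw))

  dist-complement-≤2 : ∀ i j → dist H i j ≤ 2
  dist-complement-≤2 i j with i ≟ j
  ... | yes refl rewrite dist-refl H i = z≤n
  ... | no i≢j with adj G i j in a
  ...   | true  = ≤-reflexive (dist-complement-edge a)
  ...   | false rewrite dist-complement-nonedge G i≢j a = s≤s z≤n

  ecc-complement : ∀ {i m} → adj G i m ≡ true → ecc H i ≡ 2
  ecc-complement {i} a = ecc≡ H (dist-complement-≤2 i) (dist-complement-edge a)

  εM-complement : Connected G → ∀ i j → εM H i j ≡ 2 * adjacency G i j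
  εM-complement conn i j with i ≟ j
  ... | yes refl rewrite adj-irrefl G i = εM-diagonal H i
  ... | no i≢j with adj G i j in a
  ...   | true rewrite dist-complement-edge a | ecc-complement a
                     | ecc-complement (trans (adj-sym G j i) a) = refl
  ...   | false with connected⇒neighbour G conn i≢j | connected⇒neighbour G conn (≢-sym i≢j)
  ...     | _ , aim | _ , ajm rewrite dist-complement-nonedge G i≢j a
                                    | ecc-complement aim | ecc-complement ajm = refl

theorem4p2 : (p q : ℕ) (G : Graph p) → Connected G → edges G ≡ q → Dagger G →
    Wε (complement G) ≡ 2 * q
theorem4p2 p _ G conn refl dagger = begin
  Wε H
    ≡⟨ cong (_/ 2) (double-sum-allFin (εM H)) ⟩
  (∑[ i < p ] ∑[ j < p ] εM H i j) / 2
    ≡⟨ cong (_/ 2) (sum-cong-≗ λ i → sum-cong-≗ (εM-complement G dagger conn i)) ⟩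
  (∑[ i < p ] ∑[ j < p ] (2 * adjacency G i j)) / 2
    ≡⟨ cong (_/ 2) (sym (*-distribˡ-double-sum 2 (adjacency G))) ⟩
  2 * (∑[ i < p ] ∑[ j < p ] adjacency G i j) / 2
    ≡⟨ cong (λ s → 2 * s / 2) (handshake G) ⟩
  2 * (2 * edges G) / 2
    ≡⟨ cong (_/ 2) (*-comm 2 (2 * edges G)) ⟩
  2 * edges G * 2 / 2
    ≡⟨ m*n/n≡m (2 * edges G) 2 ⟩
  2 * edges G ∎
  where
  open ≡-Reasoning
  H = complement G
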